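{- Let $G$ be an $r$-regular interval colorable graph and let $m$ be a positive integer. Then $G\square P_m$ is interval colorable and $$W(G\square P_m)\geq W(G)+W(P_m)+(m-1)r,$$ where $W(P_m)=m-1$.
   Context: All graphs are finite, undirected, without loops or multiple edges. An edge-coloring of a graph $G$ with colors $1,\ldots,t$ is an interval $t$-coloring if all $t$ colors are used, and the colors of the edges incident to each vertex are distinct and form an interval of consecutive integers. A graph is interval colorable if it has an interval $t$-coloring for some positive integer $t$; for such a graph, $W(G)$ is the greatest such $t$. $P_m$ is the path on $m$ vertices, and the value $W(P_m)$ is taken to be $m-1$. The Cartesian product $G\square H$ has vertex set $V(G)\times V(H)$, with $(u_1,v_1)(u_2,v_2)$ an edge iff either $u_1=u_2$ and $v_1v_2\in E(H)$, or $v_1=v_2$ and $u_1u_2\in E(G)$. -}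

module Defs where

open import Data.Nat using (ℕ; suc; _+_; _*_; _∸_; _≤_)
open import Data.Nat.Properties using (_≟_)
open import Data.Bool using (Bool; true; false; _∧_; _∨_)
open import Data.Fin using (Fin; toℕ)
open import Data.Fin.Properties using (*↔×)
import Data.Fin.Properties as FinP
open import Data.Product using (Σ; ∃; ∃-syntax; _×_; _,_)
open import Data.Product.Properties using (≡-dec)
open import Data.Product.Function.NonDependent.Propositional using (_×-↔_)
open import Function.Bundles using (_↔_)
open import Function.Properties.Inverse using (↔-trans; ↔-sym; ↔-refl)
open import Relation.Binary.Definitions using (DecidableEquality)
open import Relation.Binary.PropositionalEquality using (_≡_; refl)
import Relation.Binary.PropositionalEquality as ≡
open import Relation.Nullary using (yes; no)
open import Data.Empty using (⊥-elim)
open import Data.Bool.Properties using (∨-comm; ∧-zeroʳ)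
open import Data.Nat.Properties using (n<1+n; <-irrefl)
open import Relation.Nullary.Decidable using (⌊_⌋)

record Graph : Set₁ where
  field
    V      : Set
    size   : ℕ
    enum   : V ↔ Fin size
    _≟V_   : DecidableEquality V
    adj    : V → V → Bool
    sym    : ∀ u v → adj u v ≡ adj v u
    irrefl : ∀ v → adj v v ≡ false

open Graph public

Adj : (G : Graph) → V G → V G → Set
Adj G u v = adj G u v ≡ true

Regular : (G : Graph) → ℕ → Set
Regular G r = ∀ v → Fin r ↔ Σ (V G) (λ u → Adj G v u)

record IntervalColoring (G : Graph) (t : ℕ) : Set where
  field
    c        : V G → V G → ℕ
    c-sym    : ∀ {u v} → Adj G u v → c u v ≡ c v u
    c-range  : ∀ {u v} → Adj G u v → 1 ≤ c u v × c u v ≤ t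
    c-onto   : ∀ k → 1 ≤ k → k ≤ t → ∃[ u ] ∃[ v ] (Adj G u v × c u v ≡ k)
    c-proper : ∀ {v u w} → Adj G v u → Adj G v w → c v u ≡ c v w → u ≡ w
    c-interval : ∀ {v u w} k → Adj G v u → Adj G v w → c v u ≤ k → k ≤ c v w →
                 ∃[ x ] (Adj G v x × c v x ≡ k)

IntervalColorable : Graph → Set
IntervalColorable G = ∃[ t ] (1 ≤ t × IntervalColoring G t)

IsW : Graph → ℕ → Set
IsW G w = IntervalColoring G w × (∀ t → IntervalColoring G t → t ≤ w)

private
  suc≟-false : ∀ n → ⌊ suc n ≟ n ⌋ ≡ false
  suc≟-false n with suc n ≟ n
  ... | yes p = ⊥-elim (<-irrefl (≡.sym p) (n<1+n n))
  ... | no _ = refl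

  ⌊≟⌋-sym : ∀ {A : Set} (d : DecidableEquality A) x y → ⌊ d x y ⌋ ≡ ⌊ d y x ⌋
  ⌊≟⌋-sym d x y with d x y | d y x
  ... | yes _ | yes _ = refl
  ... | no _  | no _  = refl
  ... | yes p | no q  = ⊥-elim (q (≡.sym p))
  ... | no q  | yes p = ⊥-elim (q (≡.sym p))

P : ℕ → Graph
P m = record
  { V = Fin m ; size = m ; enum = ↔-refl
  ; _≟V_ = FinP._≟_
  ; adj = λ i j → ⌊ suc (toℕ i) ≟ toℕ j ⌋ ∨ ⌊ suc (toℕ j) ≟ toℕ i ⌋
  ; sym = λ i j → ∨-comm ⌊ suc (toℕ i) ≟ toℕ j ⌋ ⌊ suc (toℕ j) ≟ toℕ i ⌋
  ; irrefl = λ i → ≡.cong (λ b → b ∨ b) (suc≟-false (toℕ i)) }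

_□_ : Graph → Graph → Graph
G □ H = record
  { V = V G × V H ; size = size G * size H
  ; enum = ↔-trans (enum G ×-↔ enum H) (↔-sym *↔×)
  ; _≟V_ = ≡-dec (_≟V_ G) (_≟V_ H)
  ; adj = λ { (u₁ , v₁) (u₂ , v₂) →
        (⌊ _≟V_ G u₁ u₂ ⌋ ∧ adj H v₁ v₂) ∨ (⌊ _≟V_ H v₁ v₂ ⌋ ∧ adj G u₁ u₂) }
  ; sym = λ { (u₁ , v₁) (u₂ , v₂) →
        ≡.cong₂ _∨_ (≡.cong₂ _∧_ (⌊≟⌋-sym (_≟V_ G) u₁ u₂) (Graph.sym H v₁ v₂))
                    (≡.cong₂ _∧_ (⌊≟⌋-sym (_≟V_ H) v₁ v₂) (Graph.sym G u₁ u₂)) }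
  ; irrefl = λ { (u , v) →
        ≡.cong₂ _∨_ (≡.trans (≡.cong (⌊ _≟V_ G u u ⌋ ∧_) (irrefl H v)) (∧-zeroʳ _))
                    (≡.trans (≡.cong (⌊ _≟V_ H v v ⌋ ∧_) (irrefl G u)) (∧-zeroʳ _)) } }

-- Let α be an interval w-coloring of G, r = deg ≥ 1 and R = r + 1.  Since α is
-- proper and interval at every vertex u, the r colors at u are exactly
-- low u, low u + 1, …, low u + r - 1 for some low u ≥ 1.  Color G □ P_m by
--   (u,i)(v,i)    ↦ α(uv) + i·R            (copy i of G, shifted by i·R),
--   (u,i)(u,i+1)  ↦ low u + r + i·R        (the rung above u between copies).
-- At (u,i) the colors are then low u + i·R - 1 (rung below), the block
-- low u + i·R … low u + r - 1 + i·R (copy i), and low u + r + i·R (rung above):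
-- an interval.  Every color 1 … w + (m-1)·R is used: copy i covers
-- 1 + i·R … w + i·R, and the rung at a vertex with low u = 1 fills the gap.
-- As w + (m-1)·R = w + (m-1) + (m-1)·r, the bound follows from maximality of W.
module Submission where

open import Defs hiding (sym)
open import Data.Nat using (ℕ; zero; suc; _+_; _*_; _∸_; _≤_; _<_; _⊓_; z<s; s≤s; s≤s⁻¹; _≟_; _<?_; _≤?_)
open import Data.Nat.Properties hiding (_≟_; _<?_; _≤?_)
open import Data.Nat.Tactic.RingSolver using (solve-∀)
open import Data.Product using (_×_; _,_; Σ; ∃-syntax; proj₁; proj₂)
open import Data.Sum using (_⊎_; inj₁; inj₂)
open import Data.Fin using (Fin; toℕ; fromℕ<)
open import Data.Fin.Properties using (toℕ-injective; toℕ<n; toℕ-fromℕ<; toℕ≤pred[n]; injective⇒≤; any?)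
import Data.Fin.Properties as Fin
open import Data.Bool using (true; false; _∧_; _∨_)
import Data.Bool.Properties as Bool
open import Data.Empty using (⊥; ⊥-elim)
open import Function.Bundles using (Inverse)
open import Function.Definitions using (Injective)
open import Relation.Binary.PropositionalEquality using (_≡_; _≢_; refl; sym; trans; cong; cong₂; subst; subst₂)
open import Relation.Nullary using (Dec; yes; no)
open import Relation.Nullary.Decidable using (⌊_⌋)
open import Axiom.UniquenessOfIdentityProofs using (module Decidable⇒UIP)

∨-true⁻ : ∀ {a b} → a ∨ b ≡ true → a ≡ true ⊎ b ≡ true
∨-true⁻ {true}  _ = inj₁ refl
∨-true⁻ {false} e = inj₂ e

∧-true⁻ : ∀ {a b} → a ∧ b ≡ true → a ≡ true × b ≡ true
∧-true⁻ {true}  e = refl , e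
∧-true⁻ {false} ()

∨-trueˡ : ∀ {a b} → a ≡ true → a ∨ b ≡ true
∨-trueˡ refl = refl

∨-trueʳ : ∀ {a b} → b ≡ true → a ∨ b ≡ true
∨-trueʳ {true}  _ = refl
∨-trueʳ {false} e = e

∧-true : ∀ {a b} → a ≡ true → b ≡ true → a ∧ b ≡ true
∧-true refl e = e

⌊⌋-true⁻ : ∀ {A : Set} (d : Dec A) → ⌊ d ⌋ ≡ true → A
⌊⌋-true⁻ (yes p) _ = p
⌊⌋-true⁻ (no _)  ()

⌊⌋-true : ∀ {A : Set} (d : Dec A) → A → ⌊ d ⌋ ≡ true
⌊⌋-true (yes _) _ = refl
⌊⌋-true (no ¬p) p = ⊥-elim (¬p p)

adjacent-≡ : ∀ {G u} {p q : Σ (V G) (Adj G u)} → proj₁ p ≡ proj₁ q → p ≡ q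
adjacent-≡ {p = v , a} {.v , b} refl = cong (v ,_) (Decidable⇒UIP.≡-irrelevant Bool._≟_ a b)

argmin : ∀ {n} (f : Fin (suc n) → ℕ) → ∃[ k ] (∀ j → f k ≤ f j)
argmin {zero} f = Fin.zero , λ { Fin.zero → ≤-refl }
argmin {suc n} f with argmin (λ j → f (Fin.suc j))
... | k , k-min with f Fin.zero ≤? f (Fin.suc k)
...   | yes le = Fin.zero , λ { Fin.zero → ≤-refl ; (Fin.suc j) → ≤-trans le (k-min j) }
...   | no gt  = Fin.suc k , λ { Fin.zero → <⇒≤ (≰⇒> gt) ; (Fin.suc j) → k-min j }

Convex : ∀ {n} → (Fin n → ℕ) → Set
Convex f = ∀ {x y} k → f x ≤ k → k ≤ f y → ∃[ z ] f z ≡ k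

-- A convex family with values ≤ a and ≥ a + j takes the j + 1 distinct values
-- a, …, a + j, hence has more than j members.
span-bound : ∀ {n} (f : Fin n → ℕ) → Convex f →
  ∀ {x y} a j → f x ≤ a → a + j ≤ f y → suc j ≤ n
span-bound {n} f convex {x} {y} a j fx≤a a+j≤fy = injective⇒≤ {f = index} index-injective
  where
  hit : (i : Fin (suc j)) → ∃[ z ] f z ≡ a + toℕ i
  hit i = convex (a + toℕ i) (≤-trans fx≤a (m≤m+n a (toℕ i)))
                 (≤-trans (+-monoʳ-≤ a (s≤s⁻¹ (toℕ<n i))) a+j≤fy)
  index : Fin (suc j) → Fin n
  index i = proj₁ (hit i)
  index-injective : Injective _≡_ _≡_ index
  index-injective {i} {i′} e = toℕ-injective (+-cancelˡ-≡ a _ _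
    (trans (sym (proj₂ (hit i))) (trans (cong f e) (proj₂ (hit i′)))))

window-bound : ∀ {n} (f : Fin n → ℕ) → Injective _≡_ _≡_ f →
  ∀ a j → (∀ k → a ≤ f k) → (∀ k → f k < a + j) → n ≤ j
window-bound {n} f f-injective a j above below = injective⇒≤ {f = offset} offset-injective
  where
  offset< : ∀ k → f k ∸ a < j
  offset< k = subst (f k ∸ a <_) (m+n∸m≡n a j) (∸-monoˡ-< (below k) (above k))
  offset : Fin n → Fin j
  offset k = fromℕ< (offset< k)
  offset-injective : Injective _≡_ _≡_ offset
  offset-injective {x} {y} e = f-injective (∸-cancelʳ-≡ (above x) (above y)
    (trans (sym (toℕ-fromℕ< (offset< x))) (trans (cong toℕ e) (toℕ-fromℕ< (offset< y)))))

module ConsecutiveValues {n} (f : Fin (suc n) → ℕ)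
  (f-injective : Injective _≡_ _≡_ f) (convex : Convex f) where

  lowest : Fin (suc n)
  lowest = proj₁ (argmin f)

  low : ℕ
  low = f lowest

  low-≤ : ∀ k → low ≤ f k
  low-≤ = proj₂ (argmin f)

  <low+size : ∀ k → f k < low + suc n
  <low+size k with f k <? low + suc n
  ... | yes lt = lt
  ... | no ge  = ⊥-elim (1+n≰n (span-bound f convex low (suc n) ≤-refl (≮⇒≥ ge)))

  attained : ∀ j → j < suc n → ∃[ z ] f z ≡ low + j
  attained j j<size with any? (λ z → f z ≟ low + j)
  ... | yes found = found
  ... | no missing = ⊥-elim (<⇒≱ j<size (window-bound f f-injective low j low-≤ below))
    where
    -- a value ≥ low + j would put low + j between two values
    below : ∀ k → f k < low + j
    below k with f k <? low + j
    ... | yes lt = lt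
    ... | no ge  = ⊥-elim (missing (convex (low + j) (m≤m+n low j) (≮⇒≥ ge)))

module Spectrum {G : Graph} {r′ : ℕ} (reg : Regular G (suc r′)) {w : ℕ}
  (C : IntervalColoring G w) where

  open IntervalColoring C renaming (c to α)

  r : ℕ
  r = suc r′

  neighbour : V G → Fin r → V G
  neighbour u k = proj₁ (Inverse.to (reg u) k)

  neighbour-adj : ∀ u k → Adj G u (neighbour u k)
  neighbour-adj u k = proj₂ (Inverse.to (reg u) k)

  neighbour-index : ∀ {u v} → Adj G u v → ∃[ k ] neighbour u k ≡ v
  neighbour-index {u} {v} p =
    Inverse.from (reg u) (v , p) , cong proj₁ (Inverse.strictlyInverseˡ (reg u) (v , p))

  colorsAt : V G → Fin r → ℕ
  colorsAt u k = α u (neighbour u k)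

  colorsAt-injective : ∀ u → Injective _≡_ _≡_ (colorsAt u)
  colorsAt-injective u {x} {y} e = trans (sym (Inverse.strictlyInverseʳ (reg u) x))
    (trans (cong (Inverse.from (reg u)) (adjacent-≡ {G} (c-proper (neighbour-adj u x) (neighbour-adj u y) e)))
           (Inverse.strictlyInverseʳ (reg u) y))

  colorsAt-convex : ∀ u → Convex (colorsAt u)
  colorsAt-convex u {x} {y} k lo hi
    with c-interval k (neighbour-adj u x) (neighbour-adj u y) lo hi
  ... | v , p , αuv≡k with neighbour-index p
  ...   | i , refl = i , αuv≡k

  private
    module AtVertex (u : V G) =
      ConsecutiveValues (colorsAt u) (colorsAt-injective u) (colorsAt-convex u)

  low : V G → ℕ
  low u = AtVertex.low u

  low-≤ : ∀ {u v} → Adj G u v → low u ≤ α u v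
  low-≤ {u} p with neighbour-index p
  ... | k , refl = AtVertex.low-≤ u k

  <low+r : ∀ {u v} → Adj G u v → α u v < low u + r
  <low+r {u} p with neighbour-index p
  ... | k , refl = AtVertex.<low+size u k

  low-attained : ∀ u j → j < r → ∃[ v ] (Adj G u v × α u v ≡ low u + j)
  low-attained u j j<r with AtVertex.attained u j j<r
  ... | k , e = neighbour u k , neighbour-adj u k , e

  1≤low : ∀ u → 1 ≤ low u
  1≤low u with low-attained u 0 z<s
  ... | v , p , e = subst (1 ≤_) (trans e (+-identityʳ (low u))) (proj₁ (c-range p))

  low+r′≤w : ∀ u → low u + r′ ≤ w
  low+r′≤w u with low-attained u r′ (n<1+n r′)
  ... | v , p , e = subst (_≤ w) e (proj₂ (c-range p))

  -- an endpoint of an edge of color 1 has its colors starting at 1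
  bottom-vertex : 1 ≤ w → ∃[ u ] low u ≡ 1
  bottom-vertex 1≤w with c-onto 1 ≤-refl 1≤w
  ... | u , v , p , e = u , ≤-antisym (subst (low u ≤_) e (low-≤ p)) (1≤low u)

  r≤w : 1 ≤ w → r ≤ w
  r≤w 1≤w with bottom-vertex 1≤w
  ... | u , low≡1 = ≤-trans (+-monoˡ-≤ r′ (≤-reflexive (sym low≡1))) (low+r′≤w u)

module ProductEdges (G : Graph) (m : ℕ) where

  data EdgeAt (u : V G) (i : Fin m) : V G → Fin m → Set where
    horizontal : ∀ {v} → Adj G u v → EdgeAt u i v i
    up         : ∀ {j} → suc (toℕ i) ≡ toℕ j → EdgeAt u i u j
    down       : ∀ {j} → suc (toℕ j) ≡ toℕ i → EdgeAt u i u j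

  classify : ∀ {u v i j} → Adj (G □ P m) (u , i) (v , j) → EdgeAt u i v j
  classify {u} {v} {i} {j} e
    with ∨-true⁻ {⌊ _≟V_ G u v ⌋ ∧ adj (P m) i j} {⌊ i Fin.≟ j ⌋ ∧ adj G u v} e
  ... | inj₂ copy with ∧-true⁻ {⌊ i Fin.≟ j ⌋} copy
  ...   | i≡j , p with ⌊⌋-true⁻ (i Fin.≟ j) i≡j
  ...     | refl = horizontal p
  classify {u} {v} {i} {j} e | inj₁ rung with ∧-true⁻ {⌊ _≟V_ G u v ⌋} rung
  ... | u≡v , step with ⌊⌋-true⁻ (_≟V_ G u v) u≡v
                      | ∨-true⁻ {⌊ suc (toℕ i) ≟ toℕ j ⌋} {⌊ suc (toℕ j) ≟ toℕ i ⌋} step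
  ...   | refl | inj₁ s = up (⌊⌋-true⁻ (suc (toℕ i) ≟ toℕ j) s)
  ...   | refl | inj₂ s = down (⌊⌋-true⁻ (suc (toℕ j) ≟ toℕ i) s)

  horizontal-adj : ∀ {u v i} → Adj G u v → Adj (G □ P m) (u , i) (v , i)
  horizontal-adj {u} {v} {i} p =
    ∨-trueʳ {⌊ _≟V_ G u v ⌋ ∧ adj (P m) i i} (∧-true (⌊⌋-true (i Fin.≟ i) refl) p)

  vertical-adj : ∀ {u i j} → suc (toℕ i) ≡ toℕ j → Adj (G □ P m) (u , i) (u , j)
  vertical-adj {u} {i} {j} s =
    ∨-trueˡ (∧-true (⌊⌋-true (_≟V_ G u u) refl)
                    (∨-trueˡ (⌊⌋-true (suc (toℕ i) ≟ toℕ j) s)))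

module ProductColoring {G : Graph} {r′ : ℕ} (reg : Regular G (suc r′)) {w : ℕ}
  (1≤w : 1 ≤ w) (C : IntervalColoring G w) (m : ℕ) (0<m : 0 < m) where

  open IntervalColoring C renaming (c to α)
  open Spectrum reg C
  open ProductEdges G m

  H : Graph
  H = G □ P m

  R : ℕ
  R = suc r

  M : ℕ
  M = m ∸ 1

  -- color of the rung above u joining copies n and n + 1
  rung : V G → ℕ → ℕ
  rung u n = low u + r + n * R

  color : V G → V G → ℕ → ℕ → ℕ
  color u v i j with i ≟ j
  ... | yes _ = α u v + i * R
  ... | no _  = rung u (i ⊓ j)

  colorH : V H → V H → ℕ
  colorH (u , i) (v , j) = color u v (toℕ i) (toℕ j)

  color-same : ∀ u v i → color u v i i ≡ α u v + i * R
  color-same u v i with i ≟ i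
  ... | yes _ = refl
  ... | no i≢i = ⊥-elim (i≢i refl)

  color-step : ∀ u v {i j} → suc i ≡ j → color u v i j ≡ rung u i
  color-step u v {i} {j} s with i ≟ j
  ... | yes refl = ⊥-elim (1+n≢n s)
  ... | no _ = cong (rung u) (m≤n⇒m⊓n≡m (subst (i ≤_) s (n≤1+n i)))

  color-step⁻ : ∀ u v {i j} → suc j ≡ i → color u v i j ≡ rung u j
  color-step⁻ u v {i} {j} s with i ≟ j
  ... | yes refl = ⊥-elim (1+n≢n s)
  ... | no _ = cong (rung u) (m≥n⇒m⊓n≡n (subst (j ≤_) s (n≤1+n j)))

  edgeColor : ∀ {u i v j} → EdgeAt u i v j → ℕ
  edgeColor {u} {i} (horizontal {v} _) = α u v + toℕ i * R
  edgeColor {u} {i} (up _)             = rung u (toℕ i)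
  edgeColor {u}     (down {j} _)       = rung u (toℕ j)

  colorH-edge : ∀ {u i v j} (e : EdgeAt u i v j) → colorH (u , i) (v , j) ≡ edgeColor e
  colorH-edge {u} {i} (horizontal {v} _) = color-same u v (toℕ i)
  colorH-edge {u}     (up s)             = color-step u u s
  colorH-edge {u}     (down s)           = color-step⁻ u u s

  colorH-symmetric : ∀ {u i v j} → EdgeAt u i v j → colorH (u , i) (v , j) ≡ colorH (v , j) (u , i)
  colorH-symmetric {u} {i} (horizontal {v} p) = trans (color-same u v (toℕ i))
    (trans (cong (_+ toℕ i * R) (c-sym p)) (sym (color-same v u (toℕ i))))
  colorH-symmetric {u} (up s)   = trans (color-step u u s) (sym (color-step⁻ u u s))
  colorH-symmetric {u} (down s) = trans (color-step⁻ u u s) (sym (color-step u u s))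

  total≡ : w + M + M * r ≡ w + M * R
  total≡ = trans (+-assoc w M (M * r)) (cong (w +_) (sym (*-suc M r)))

  rung≤total : ∀ u n → suc n ≤ M → rung u n ≤ w + M * R
  rung≤total u n n<M = ≤-trans (+-monoˡ-≤ (n * R) low+r≤w+R)
    (≤-trans (≤-reflexive (+-assoc w R (n * R))) (+-monoʳ-≤ w (*-monoˡ-≤ R n<M)))
    where
    low+r≤w+R : low u + r ≤ w + R
    low+r≤w+R = ≤-trans (≤-reflexive (+-suc (low u) r′))
      (≤-trans (s≤s (low+r′≤w u)) (≤-trans (s≤s (m≤m+n w r)) (≤-reflexive (sym (+-suc w r)))))

  edgeColor-range : ∀ {u i v j} (e : EdgeAt u i v j) → 1 ≤ edgeColor e × edgeColor e ≤ w + M * R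
  edgeColor-range {u} {i} (horizontal p) =
    ≤-trans (proj₁ (c-range p)) (m≤m+n _ _) ,
    +-mono-≤ (proj₂ (c-range p)) (*-monoˡ-≤ R (toℕ≤pred[n] i))
  edgeColor-range {u} {i} {_} {j} (up s) =
    ≤-trans (1≤low u) (≤-trans (m≤m+n (low u) r) (m≤m+n _ _)) ,
    rung≤total u (toℕ i) (subst (_≤ M) (sym s) (toℕ≤pred[n] j))
  edgeColor-range {u} {i} {_} {j} (down s) =
    ≤-trans (1≤low u) (≤-trans (m≤m+n (low u) r) (m≤m+n _ _)) ,
    rung≤total u (toℕ j) (subst (_≤ M) (sym s) (toℕ≤pred[n] i))

  -- the rung below copy n + 1 sits just under the block of copy n + 1
  rung-below : ∀ x n → x + suc n * R ≡ suc (x + r) + n * R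
  rung-below x n = shift x n r′
    where
    shift : ∀ x n r′ → x + suc n * suc (suc r′) ≡ suc (x + suc r′) + n * suc (suc r′)
    shift = solve-∀

  horizontal≢up : ∀ {u v} → Adj G u v → ∀ n → α u v + n * R ≢ rung u n
  horizontal≢up p n e = <⇒≢ (<low+r p) (+-cancelʳ-≡ (n * R) _ _ e)

  horizontal≢down : ∀ {u v} → Adj G u v → ∀ n → α u v + suc n * R ≢ rung u n
  horizontal≢down {u} {v} p n e = 1+n≰n (subst (_≤ α u v + r) (sym just-below) (+-monoˡ-≤ r (low-≤ p)))
    where
    just-below : suc (α u v + r) ≡ low u + r
    just-below = +-cancelʳ-≡ (n * R) _ _ (trans (sym (rung-below (α u v) n)) e)

  up≢down : ∀ u n k → suc k ≡ n → rung u n ≢ rung u k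
  up≢down u n k s e = 1+n≢n (trans s (*-cancelʳ-≡ n k R (+-cancelˡ-≡ (low u + r) _ _ e)))

  edgeColor-proper : ∀ {u i v j v′ j′} (e : EdgeAt u i v j) (e′ : EdgeAt u i v′ j′) →
    edgeColor e ≡ edgeColor e′ → _≡_ {A = V H} (v , j) (v′ , j′)
  edgeColor-proper {u} {i} (horizontal p) (horizontal q) c =
    cong (_, i) (c-proper p q (+-cancelʳ-≡ (toℕ i * R) _ _ c))
  edgeColor-proper {u} {i} (horizontal p) (up s) c = ⊥-elim (horizontal≢up p (toℕ i) c)
  edgeColor-proper {u} (horizontal p) (down {j} s) c =
    ⊥-elim (horizontal≢down p (toℕ j) (subst (λ n → α u _ + n * R ≡ _) (sym s) c))
  edgeColor-proper {u} {i} (up s) (horizontal q) c = ⊥-elim (horizontal≢up q (toℕ i) (sym c))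
  edgeColor-proper (up s) (up s′) c = cong (_ ,_) (toℕ-injective (trans (sym s) s′))
  edgeColor-proper {u} {i} (up s) (down {j} s′) c = ⊥-elim (up≢down u (toℕ i) (toℕ j) s′ c)
  edgeColor-proper {u} (down {j} s) (horizontal q) c =
    ⊥-elim (horizontal≢down q (toℕ j) (subst (λ n → α u _ + n * R ≡ _) (sym s) (sym c)))
  edgeColor-proper {u} {i} (down {j} s) (up s′) c = ⊥-elim (up≢down u (toℕ i) (toℕ j) s (sym c))
  edgeColor-proper (down s) (down s′) c = cong (_ ,_) (toℕ-injective (suc-injective (trans s (sym s′))))

  edgeColor-lower : ∀ {u i v j} (e : EdgeAt u i v j) → low u + toℕ i * R ≤ suc (edgeColor e)
  edgeColor-lower (horizontal p) = ≤-trans (+-monoˡ-≤ _ (low-≤ p)) (n≤1+n _)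
  edgeColor-lower {u} {i} (up s) = ≤-trans (+-monoˡ-≤ (toℕ i * R) (m≤m+n (low u) r)) (n≤1+n _)
  edgeColor-lower {u} (down {j} s) =
    ≤-reflexive (trans (cong (λ n → low u + n * R) (sym s)) (rung-below (low u) (toℕ j)))

  edgeColor-upper : ∀ {u i v j} (e : EdgeAt u i v j) → edgeColor e ≤ rung u (toℕ i)
  edgeColor-upper (horizontal p) = +-monoˡ-≤ _ (<⇒≤ (<low+r p))
  edgeColor-upper (up s) = ≤-refl
  edgeColor-upper {u} (down {j} s) = +-monoʳ-≤ (low u + r) (*-monoˡ-≤ R (subst (toℕ j ≤_) s (n≤1+n _)))

  block-attained : ∀ u i k → low u + toℕ i * R ≤ k → k < rung u (toℕ i) →
    ∃[ x ] (Adj H (u , i) x × colorH (u , i) x ≡ k)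
  block-attained u i k lo hi = (v , i) , horizontal-adj p , color≡k
    where
    open Relation.Binary.PropositionalEquality.≡-Reasoning
    base : ℕ
    base = low u + toℕ i * R
    regroup : ∀ x d y → x + d + y ≡ d + (x + y)
    regroup = solve-∀
    offset<r : k ∸ base < r
    offset<r = +-cancelʳ-< base (k ∸ base) r
      (subst (_< r + base) (sym (m∸n+n≡m lo)) (subst (k <_) (regroup (low u) r (toℕ i * R)) hi))
    hit : ∃[ v ] (Adj G u v × α u v ≡ low u + (k ∸ base))
    hit = low-attained u (k ∸ base) offset<r
    v : V G
    v = proj₁ hit
    p : Adj G u v
    p = proj₁ (proj₂ hit)
    color≡k : color u v (toℕ i) (toℕ i) ≡ k
    color≡k = begin
      color u v (toℕ i) (toℕ i)       ≡⟨ color-same u v (toℕ i) ⟩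
      α u v + toℕ i * R                ≡⟨ cong (_+ toℕ i * R) (proj₂ (proj₂ hit)) ⟩
      low u + (k ∸ base) + toℕ i * R   ≡⟨ regroup (low u) (k ∸ base) (toℕ i * R) ⟩
      (k ∸ base) + base                ≡⟨ m∸n+n≡m lo ⟩
      k                                ∎

  edgeColor-interval : ∀ {u i v j v′ j′} (e : EdgeAt u i v j) (e′ : EdgeAt u i v′ j′) →
    Adj H (u , i) (v , j) → Adj H (u , i) (v′ , j′) → ∀ k → edgeColor e ≤ k → k ≤ edgeColor e′ →
    ∃[ x ] (Adj H (u , i) x × colorH (u , i) x ≡ k)
  edgeColor-interval {u} {i} {v} {j} {v′} {j′} e e′ a a′ k lo hi
    with k <? low u + toℕ i * R | k <? rung u (toℕ i)
  ... | yes below | _ = (v , j) , a ,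
        trans (colorH-edge e) (≤-antisym lo (s≤s⁻¹ (≤-trans below (edgeColor-lower e))))
  ... | no _ | no above = (v′ , j′) , a′ ,
        trans (colorH-edge e′) (≤-antisym (≤-trans (edgeColor-upper e′) (≮⇒≥ above)) hi)
  ... | no not-below | yes inside = block-attained u i k (≮⇒≥ not-below) inside

  Used : ℕ → Set
  Used k = ∃[ x ] ∃[ y ] (Adj H x y × colorH x y ≡ k)

  copy-used : ∀ n (n<m : n < m) k → 1 ≤ k → k ≤ w → Used (k + n * R)
  copy-used n n<m k 1≤k k≤w with c-onto k 1≤k k≤w
  ... | u , v , p , e = (u , fromℕ< n<m) , (v , fromℕ< n<m) , horizontal-adj p ,
    trans (color-same u v (toℕ (fromℕ< n<m))) (cong₂ (λ x y → x + y * R) e (toℕ-fromℕ< n<m))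

  -- copies 0, …, n together with the rungs at a vertex with low = 1 use 1, …, w + n·R
  used-upto : ∀ n → n < m → ∀ k → 1 ≤ k → k ≤ w + n * R → Used k
  used-upto zero n<m k 1≤k k≤w with copy-used zero n<m k 1≤k (subst (k ≤_) (+-identityʳ w) k≤w)
  ... | x , y , p , e = x , y , p , trans e (+-identityʳ k)
  used-upto (suc n) n+1<m k 1≤k k≤top with k ≤? w + n * R | suc n * R <? k
  ... | yes earlier | _ = used-upto n (<-trans (n<1+n n) n+1<m) k 1≤k earlier
  ... | no _ | yes in-copy
    with copy-used (suc n) n+1<m (k ∸ suc n * R) (m<n⇒0<n∸m in-copy)
           (subst (k ∸ suc n * R ≤_) (m+n∸n≡m w (suc n * R)) (∸-monoˡ-≤ (suc n * R) k≤top))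
  ...   | x , y , p , e = x , y , p , trans e (m∸n+n≡m (<⇒≤ in-copy))
  used-upto (suc n) n+1<m k 1≤k k≤top | no later | no not-in-copy =
    (u₀ , i) , (u₀ , i′) , vertical-adj step , trans (color-step u₀ u₀ step) rung≡k
    where
    n<m : n < m
    n<m = <-trans (n<1+n n) n+1<m
    i i′ : Fin m
    i  = fromℕ< n<m
    i′ = fromℕ< n+1<m
    step : suc (toℕ i) ≡ toℕ i′
    step = trans (cong suc (toℕ-fromℕ< n<m)) (sym (toℕ-fromℕ< n+1<m))
    u₀ : V G
    u₀ = proj₁ (bottom-vertex 1≤w)
    -- w + n·R < k ≤ (n + 1)·R and r ≤ w force k = 1 + r + n·R, the rung above u₀
    rung≡k : rung u₀ (toℕ i) ≡ k
    rung≡k = trans (cong₂ (λ x y → x + r + y * R) (proj₂ (bottom-vertex 1≤w)) (toℕ-fromℕ< n<m))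
      (≤-antisym (≤-trans (s≤s (+-monoˡ-≤ (n * R) (r≤w 1≤w))) (≰⇒> later)) (≮⇒≥ not-in-copy))

  M<m : M < m
  M<m = pred<self 0<m
    where
    pred<self : ∀ {n} → 0 < n → n ∸ 1 < n
    pred<self {suc n} _ = n<1+n n

  coloring : IntervalColoring H (w + M + M * r)
  coloring = record
    { c          = colorH
    ; c-sym      = λ { {u , i} {v , j} a → colorH-symmetric (classify a) }
    ; c-range    = λ { {u , i} {v , j} a → let e = classify a in
        subst (1 ≤_) (sym (colorH-edge e)) (proj₁ (edgeColor-range e)) ,
        subst₂ _≤_ (sym (colorH-edge e)) (sym total≡) (proj₂ (edgeColor-range e)) }
    ; c-onto     = λ k 1≤k k≤t → used-upto M M<m k 1≤k (subst (k ≤_) total≡ k≤t)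
    ; c-proper   = λ { {u , i} {v , j} {v′ , j′} a a′ c →
        edgeColor-proper (classify a) (classify a′)
          (trans (sym (colorH-edge (classify a))) (trans c (colorH-edge (classify a′)))) }
    ; c-interval = λ { {u , i} {v , j} {v′ , j′} k a a′ lo hi →
        edgeColor-interval (classify a) (classify a′) a a′ k
          (subst (_≤ k) (colorH-edge (classify a)) lo) (subst (k ≤_) (colorH-edge (classify a′)) hi) }
    }

regular-zero-uncolorable : ∀ {G t} → Regular G 0 → IntervalColoring G t → 1 ≤ t → ⊥
regular-zero-uncolorable reg C 1≤t with IntervalColoring.c-onto C 1 ≤-refl 1≤t
... | u , v , p , _ with Inverse.from (reg u) (v , p)
... | ()

theorem9 : (G : Graph) (r m : ℕ) → Regular G r → IntervalColorable G → 0 < m →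
    IntervalColorable (G □ P m) ×
    (∀ w w′ → IsW G w → IsW (G □ P m) w′ → w + (m ∸ 1) + (m ∸ 1) * r ≤ w′)
theorem9 G zero m reg (t , 1≤t , C) 0<m = ⊥-elim (regular-zero-uncolorable reg C 1≤t)
theorem9 G (suc r′) m reg (t , 1≤t , C) 0<m = colorable , bound
  where
  colorable : IntervalColorable (G □ P m)
  colorable = t + (m ∸ 1) + (m ∸ 1) * suc r′ ,
    ≤-trans 1≤t (≤-trans (m≤m+n t _) (m≤m+n _ _)) ,
    ProductColoring.coloring reg 1≤t C m 0<m
  bound : ∀ w w′ → IsW G w → IsW (G □ P m) w′ → w + (m ∸ 1) + (m ∸ 1) * suc r′ ≤ w′
  bound w w′ (optimal , maximal) (_ , maximal′) =
    maximal′ _ (ProductColoring.coloring reg (≤-trans 1≤t (maximal t C)) optimal m 0<m)
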